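{- Let $\mathcal M=(\mathcal C,D,\mathtt{app},\mathtt{lam},(\bar c_i)_{i=1}^n,\mathtt{fail},\mathtt{case})$ be a $\lambda_C$-model. For any $\lambda_C$-terms $t,t'$ whose free variables are all in a list $\Gamma=x_1,\dots,x_k$ of distinct variables, $$t\equiv_{\lambda_C} t' \quad\Longrightarrow\quad [\![t]\!]_\Gamma=[\![t']\!]_\Gamma .$$
   Context: The lambda calculus with constructors ($\lambda_C$). Fix a finite set of constructors $\{c_1,\dots,c_n\}$ (constants, distinct from variables, not subject to substitution). Terms are given by $t,u::=x\mid t\,u\mid \lambda x.t\mid c\mid \{\theta\}\cdot t$, where a case-binding $\theta=\{d_1\mapsto u_1;\dots;d_k\mapsto u_k\}$ ($k\ge 0$, the $d_j$ pairwise distinct constructors) is a finite partial function from constructors to terms with domain $\mathrm{dom}(\theta)=\{d_1,\dots,d_k\}$. Terms are considered up to $\alpha$-conversion. Composition of case-bindings: $\theta\circ\{d_1\mapsto t_1;\dots;d_k\mapsto t_k\}=\{d_1\mapsto \{\theta\}\cdot t_1;\dots;d_k\mapsto\{\theta\}\cdot t_k\}$. One-step reduction $\to$ is the contextual closure (also inside case-bindings) of the six rules: (AppLam) $(\lambda x.t)u\to t[x:=u]$; (LamApp) $\lambda x.t\,x\to t$ if $x\notin FV(t)$; (CaseCons) $\{\theta\}\cdot c\to t$ if $(c\mapsto t)\in\theta$; (CaseApp) $\{\theta\}\cdot(t\,u)\to(\{\theta\}\cdot t)\,u$; (CaseLam) $\{\theta\}\cdot\lambda x.t\to\lambda x.\{\theta\}\cdot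 t$ if $x\notin FV(\theta)$; (CaseCase) $\{\theta\}\cdot\{\phi\}\cdot t\to\{\theta\circ\phi\}\cdot t$. $\equiv_{\lambda_C}$ is the reflexive, symmetric, transitive closure of $\to$. Categorical notation: in a cartesian closed category, composition is written in diagrammatic order $f;g$ (first $f$, then $g$); $\langle f,g\rangle$ is pairing, $\pi^k_i$ the $i$-th projection of a $k$-ary product ($\pi_i=\pi^2_i$), $!_A:A\to 1$ the unique map to the terminal object, $D^k$ the $k$-fold product, $B^A$ the exponential, $\mathrm{ev}:B^A\times A\to B$ evaluation, $\Lambda(f):C\to B^A$ the currying of $f:C\times A\to B$; $\alpha$ denotes canonical associativity isomorphisms $(A\times B)\times C\to A\times(B\times C)$. A $\lambda_C$-model is a tuple $(\mathcal C,D,\mathtt{app},\mathtt{lam},(\bar c_i)_{i=1}^n,\mathtt{fail},\mathtt{case})$ with $\mathcal C$ cartesian closed, $D$ an object, $\bar c_i,\mathtt{fail}:1\to D$, $\mathtt{app}:D\to D^D$, $\mathtt{lam}:D^D\to D$, $\mathtt{case}:D^n\times D\to D$, such that, with $\widehat{\mathtt{case}}=\Lambda(\alpha;(\mathrm{id}_{D^n}\times\mathrm{ev});\mathtt{case}):D^n\times D^D\to D^D$ and $\mathtt{comp}=\langle(\mathrm{id}_{D^n}\times\pi^n_1);\mathtt{case},\dots,(\mathrm{id}_{D^n}\times\pi^n_n);\mathtt{case}\rangle:D^n\times D^n\to D^n$: (D1) $\mathtt{lam};\mathtt{app}=\mathrm{id}_{D^D}$ and $\mathtt{app};\mathtt{lam}=\mathrm{id}_D$;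 (D2) for every $i\in\{1,\dots,n\}$, $\langle\mathrm{id}_{D^n},!_{D^n}\rangle;(\mathrm{id}_{D^n}\times\bar c_i);\mathtt{case}=\pi^n_i$; (D3) $(\mathtt{case}\times\mathrm{id}_D);(\mathtt{app}\times\mathrm{id}_D);\mathrm{ev}=\alpha;(\mathrm{id}_{D^n}\times(\mathtt{app}\times\mathrm{id}_D));(\mathrm{id}_{D^n}\times\mathrm{ev});\mathtt{case}$ as maps $(D^n\times D)\times D\to D$; (D4) $\widehat{\mathtt{case}};\mathtt{lam}=(\mathrm{id}_{D^n}\times\mathtt{lam});\mathtt{case}$; (D5) $(\mathtt{comp}\times\mathrm{id}_D);\mathtt{case}=\alpha;(\mathrm{id}_{D^n}\times\mathtt{case});\mathtt{case}$ as maps $(D^n\times D^n)\times D\to D$; (D6) $(\mathrm{id}_{D^n}\times\mathtt{fail});\mathtt{case}=\pi_2;\mathtt{fail}$ as maps $D^n\times 1\to D$. Interpretation: for $\Gamma=x_1,\dots,x_k$ containing the free variables, $[\![t]\!]_\Gamma:D^k\to D$ and for case-bindings $[\![\theta]\!]_\Gamma:D^k\to D^n$ are defined by: $[\![x_i]\!]_\Gamma=\pi^k_i$; $[\![t\,u]\!]_\Gamma=\langle[\![t]\!]_\Gamma,[\![u]\!]_\Gamma\rangle;(\mathtt{app}\times\mathrm{id}_D);\mathrm{ev}$; $[\![\lambda x_{k+1}.t]\!]_\Gamma=\Lambda(f_t);\mathtt{lam}$ (bound variable renamed so $x_{k+1}\notin\Gamma$), where $f_t:D^k\times D\to D$ is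 the canonical iso $D^k\times D\cong D^{k+1}$ followed by $[\![t]\!]_{\Gamma,x_{k+1}}$; $[\![c_i]\!]_\Gamma=!_{D^k};\bar c_i$; $[\![\{\theta\}\cdot t]\!]_\Gamma=\langle[\![\theta]\!]_\Gamma,[\![t]\!]_\Gamma\rangle;\mathtt{case}$; $[\![\theta]\!]_\Gamma=\langle f_1,\dots,f_n\rangle$ with $f_i=[\![u_i]\!]_\Gamma$ if $(c_i\mapsto u_i)\in\theta$ and $f_i=!_{D^k};\mathtt{fail}$ if $c_i\notin\mathrm{dom}(\theta)$. -}

module Defs where

open import Level using (Level; _⊔_) renaming (suc to lsuc)
open import Data.Nat using (ℕ; zero; suc; _<_)
open import Data.Fin using (Fin; zero; suc; fromℕ<; opposite)
open import Data.Vec using (Vec; []; _∷_)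
open import Data.Maybe using (Maybe; just; nothing)
open import Relation.Binary using (Rel; IsEquivalence)
open import Relation.Binary.PropositionalEquality using (_≡_)
open import Relation.Binary.Construct.Closure.Equivalence using (EqClosure)

record CCC (o ℓ e : Level) : Set (lsuc (o ⊔ ℓ ⊔ e)) where
  infixr 9 _⨾_
  infix  4 _≈_
  infixr 7 _×_
  infixr 10 _⊗_
  infix  5 _⇒_
  infixr 8 _^_
  field
    Obj  : Set o
    _⇒_  : Obj → Obj → Set ℓ
    _≈_  : ∀ {A B} → Rel (A ⇒ B) e
    ≈-isEquivalence : ∀ {A B} → IsEquivalence (_≈_ {A} {B})
    id   : ∀ {A} → A ⇒ A
    _⨾_  : ∀ {A B C} → A ⇒ B → B ⇒ C → A ⇒ C     -- f ⨾ g : first f, then g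
    ⨾-resp-≈  : ∀ {A B C} {f f′ : A ⇒ B} {g g′ : B ⇒ C} →
                f ≈ f′ → g ≈ g′ → f ⨾ g ≈ f′ ⨾ g′
    identityˡ : ∀ {A B} {f : A ⇒ B} → id ⨾ f ≈ f
    identityʳ : ∀ {A B} {f : A ⇒ B} → f ⨾ id ≈ f
    assoc     : ∀ {A B C E} {f : A ⇒ B} {g : B ⇒ C} {h : C ⇒ E} →
                (f ⨾ g) ⨾ h ≈ f ⨾ (g ⨾ h)
    ⊤        : Obj
    !        : ∀ {A} → A ⇒ ⊤
    !-unique : ∀ {A} (f : A ⇒ ⊤) → f ≈ !
    _×_   : Obj → Obj → Obj
    π₁    : ∀ {A B} → A × B ⇒ A
    π₂    : ∀ {A B} → A × B ⇒ B
    ⟨_,_⟩ : ∀ {C A B} → C ⇒ A → C ⇒ B → C ⇒ A × B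
    π₁-β  : ∀ {C A B} {f : C ⇒ A} {g : C ⇒ B} → ⟨ f , g ⟩ ⨾ π₁ ≈ f
    π₂-β  : ∀ {C A B} {f : C ⇒ A} {g : C ⇒ B} → ⟨ f , g ⟩ ⨾ π₂ ≈ g
    ⟨⟩-unique : ∀ {C A B} {f : C ⇒ A} {g : C ⇒ B} {h : C ⇒ A × B} →
                h ⨾ π₁ ≈ f → h ⨾ π₂ ≈ g → h ≈ ⟨ f , g ⟩

  _⊗_ : ∀ {A B C E} → A ⇒ B → C ⇒ E → A × C ⇒ B × E
  f ⊗ g = ⟨ π₁ ⨾ f , π₂ ⨾ g ⟩

  field
    _^_ : Obj → Obj → Obj
    ev  : ∀ {A B} → (B ^ A) × A ⇒ B
    Λ   : ∀ {C A B} → C × A ⇒ B → C ⇒ B ^ A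
    Λ-β : ∀ {C A B} {f : C × A ⇒ B} → (Λ f ⊗ id) ⨾ ev ≈ f
    Λ-unique : ∀ {C A B} {f : C × A ⇒ B} {h : C ⇒ B ^ A} →
               (h ⊗ id) ⨾ ev ≈ f → h ≈ Λ f

module CCCKit {o ℓ e} (𝒞 : CCC o ℓ e) where
  open CCC 𝒞

  Pow : Obj → ℕ → Obj
  Pow D zero    = ⊤
  Pow D (suc k) = D × Pow D k

  proj : ∀ {D} k → Fin k → Pow D k ⇒ D
  proj (suc k) zero    = π₁
  proj (suc k) (suc i) = π₂ ⨾ proj k i

  tuple : ∀ {X D} k → (Fin k → X ⇒ D) → X ⇒ Pow D k
  tuple zero    f = !
  tuple (suc k) f = ⟨ f zero , tuple k (λ i → f (suc i)) ⟩

  α : ∀ {A B C} → (A × B) × C ⇒ A × (B × C)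
  α = ⟨ π₁ ⨾ π₁ , ⟨ π₁ ⨾ π₂ , π₂ ⟩ ⟩

  -- canonical iso D^k × D ≅ D^(k+1)  (the new component goes last)
  snoc : ∀ {D} k → Pow D k × D ⇒ Pow D (suc k)
  snoc zero    = ⟨ π₂ , ! ⟩
  snoc (suc k) = ⟨ π₁ ⨾ π₁ , ⟨ π₁ ⨾ π₂ , π₂ ⟩ ⨾ snoc k ⟩

record LCModel {o ℓ e} (𝒞 : CCC o ℓ e) (n : ℕ) : Set (o ⊔ ℓ ⊔ e) where
  open CCC 𝒞
  open CCCKit 𝒞
  field
    D    : Obj
    app  : D ⇒ D ^ D
    lam  : D ^ D ⇒ D
    cbar : Fin n → ⊤ ⇒ D
    fail : ⊤ ⇒ D
    case : Pow D n × D ⇒ D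

  caseHat : Pow D n × (D ^ D) ⇒ D ^ D
  caseHat = Λ (α ⨾ (id ⊗ ev) ⨾ case)

  comp : Pow D n × Pow D n ⇒ Pow D n
  comp = tuple n (λ i → (id ⊗ proj n i) ⨾ case)

  field
    D1a : lam ⨾ app ≈ id
    D1b : app ⨾ lam ≈ id
    D2  : ∀ (i : Fin n) → ⟨ id , ! ⟩ ⨾ (id ⊗ cbar i) ⨾ case ≈ proj n i
    D3  : (case ⊗ id) ⨾ (app ⊗ id) ⨾ ev
            ≈ α ⨾ (id ⊗ (app ⊗ id)) ⨾ (id ⊗ ev) ⨾ case
    D4  : caseHat ⨾ lam ≈ (id ⊗ lam) ⨾ case
    D5  : (comp ⊗ id) ⨾ case ≈ α ⨾ (id ⊗ case) ⨾ case
    D6  : (id ⊗ fail) ⨾ case ≈ π₂ ⨾ fail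

-- λ_C terms (de Bruijn indices; α-conversion is built in)

module Syntax (n : ℕ) where

  -- a case-binding is a finite partial function from the n constructors
  -- to terms, represented as a vector indexed by constructors
  data Tm : Set where
    var  : ℕ → Tm
    _·_  : Tm → Tm → Tm
    ƛ    : Tm → Tm
    con  : Fin n → Tm
    case : Vec (Maybe Tm) n → Tm → Tm

  Binding : Set
  Binding = Vec (Maybe Tm) n

  ext : (ℕ → ℕ) → ℕ → ℕ
  ext ρ zero    = zero
  ext ρ (suc x) = suc (ρ x)

  mutual
    ren : (ℕ → ℕ) → Tm → Tm
    ren ρ (var x)    = var (ρ x)
    ren ρ (t · u)    = ren ρ t · ren ρ u
    ren ρ (ƛ t)      = ƛ (ren (ext ρ) t)
    ren ρ (con c)    = con c
    ren ρ (case θ t) = case (renB ρ θ) (ren ρ t)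

    renB : ∀ {m} → (ℕ → ℕ) → Vec (Maybe Tm) m → Vec (Maybe Tm) m
    renB ρ []       = []
    renB ρ (x ∷ xs) = renM ρ x ∷ renB ρ xs

    renM : (ℕ → ℕ) → Maybe Tm → Maybe Tm
    renM ρ nothing  = nothing
    renM ρ (just t) = just (ren ρ t)

  ↑ : Tm → Tm
  ↑ = ren suc

  ↑B : Binding → Binding
  ↑B = renB suc

  exts : (ℕ → Tm) → ℕ → Tm
  exts σ zero    = var zero
  exts σ (suc x) = ↑ (σ x)

  mutual
    sub : (ℕ → Tm) → Tm → Tm
    sub σ (var x)    = σ x
    sub σ (t · u)    = sub σ t · sub σ u
    sub σ (ƛ t)      = ƛ (sub (exts σ) t)
    sub σ (con c)    = con c
    sub σ (case θ t) = case (subB σ θ) (sub σ t)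

    subB : ∀ {m} → (ℕ → Tm) → Vec (Maybe Tm) m → Vec (Maybe Tm) m
    subB σ []       = []
    subB σ (x ∷ xs) = subM σ x ∷ subB σ xs

    subM : (ℕ → Tm) → Maybe Tm → Maybe Tm
    subM σ nothing  = nothing
    subM σ (just t) = just (sub σ t)

  σ₀ : Tm → ℕ → Tm
  σ₀ u zero    = u
  σ₀ u (suc x) = var x

  _[_] : Tm → Tm → Tm
  t [ u ] = sub (σ₀ u) t

  mutual
    compB : ∀ {m} → Binding → Vec (Maybe Tm) m → Vec (Maybe Tm) m
    compB θ []       = []
    compB θ (x ∷ xs) = compM θ x ∷ compB θ xs

    compM : Binding → Maybe Tm → Maybe Tm
    compM θ nothing  = nothing
    compM θ (just t) = just (case θ t)

  _∋_↦_ : ∀ {m} → Vec (Maybe Tm) m → Fin m → Tm → Set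
  (x ∷ xs) ∋ zero  ↦ u = x ≡ just u
  (x ∷ xs) ∋ suc c ↦ u = xs ∋ c ↦ u

  infix 3 _⟶_ _⟶B_
  mutual
    data _⟶_ : Tm → Tm → Set where
      AppLam   : ∀ {t u} → (ƛ t) · u ⟶ t [ u ]
      LamApp   : ∀ {t} → ƛ (↑ t · var zero) ⟶ t
      CaseCons : ∀ {θ c u} → θ ∋ c ↦ u → case θ (con c) ⟶ u
      CaseApp  : ∀ {θ t u} → case θ (t · u) ⟶ case θ t · u
      CaseLam  : ∀ {θ t} → case θ (ƛ t) ⟶ ƛ (case (↑B θ) t)
      CaseCase : ∀ {θ φ t} → case θ (case φ t) ⟶ case (compB θ φ) t
      ξ-appˡ   : ∀ {t t′ u} → t ⟶ t′ → t · u ⟶ t′ · u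
      ξ-appʳ   : ∀ {t u u′} → u ⟶ u′ → t · u ⟶ t · u′
      ξ-lam    : ∀ {t t′} → t ⟶ t′ → ƛ t ⟶ ƛ t′
      ξ-caseB  : ∀ {θ θ′ t} → θ ⟶B θ′ → case θ t ⟶ case θ′ t
      ξ-case   : ∀ {θ t t′} → t ⟶ t′ → case θ t ⟶ case θ t′

    data _⟶B_ : ∀ {m} → Vec (Maybe Tm) m → Vec (Maybe Tm) m → Set where
      here  : ∀ {m u u′} {xs : Vec (Maybe Tm) m} →
              u ⟶ u′ → just u ∷ xs ⟶B just u′ ∷ xs
      there : ∀ {m x} {xs xs′ : Vec (Maybe Tm) m} →
              xs ⟶B xs′ → x ∷ xs ⟶B x ∷ xs′

  infix 3 _≡λC_
  _≡λC_ : Tm → Tm → Set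
  _≡λC_ = EqClosure _⟶_

  -- "all free variables of t are among x_1,…,x_k":
  -- every free de Bruijn index is < k  (index j denotes x_(k-j))
  mutual
    data Scoped (k : ℕ) : Tm → Set where
      var  : ∀ {j} → j < k → Scoped k (var j)
      _·_  : ∀ {t u} → Scoped k t → Scoped k u → Scoped k (t · u)
      ƛ    : ∀ {t} → Scoped (suc k) t → Scoped k (ƛ t)
      con  : ∀ {c} → Scoped k (con c)
      case : ∀ {θ t} → ScopedB k θ → Scoped k t → Scoped k (case θ t)

    data ScopedB (k : ℕ) : ∀ {m} → Vec (Maybe Tm) m → Set where
      []  : ScopedB k []
      _∷_ : ∀ {m x} {xs : Vec (Maybe Tm) m} →
            ScopedM k x → ScopedB k xs → ScopedB k (x ∷ xs)

    data ScopedM (k : ℕ) : Maybe Tm → Set where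
      nothing : ScopedM k nothing
      just    : ∀ {t} → Scoped k t → ScopedM k (just t)

module Interp {o ℓ e} (𝒞 : CCC o ℓ e) {n : ℕ} (M : LCModel 𝒞 n) where
  open CCC 𝒞
  open CCCKit 𝒞
  open LCModel M renaming (case to caseᴹ)
  open Syntax n

  mutual
    ⟦_⟧ : ∀ {k t} → Scoped k t → Pow D k ⇒ D
    ⟦_⟧ {k} (var j<k)   = proj k (opposite (fromℕ< j<k))
    ⟦ p · q ⟧           = ⟨ ⟦ p ⟧ , ⟦ q ⟧ ⟩ ⨾ (app ⊗ id) ⨾ ev
    ⟦_⟧ {k} (ƛ p)       = Λ (snoc k ⨾ ⟦ p ⟧) ⨾ lam
    ⟦_⟧ {k} (con {c})   = ! ⨾ cbar c
    ⟦ case pθ p ⟧       = ⟨ ⟦ pθ ⟧B , ⟦ p ⟧ ⟩ ⨾ caseᴹ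

    ⟦_⟧B : ∀ {k m} {θ : Vec (Maybe Tm) m} → ScopedB k θ → Pow D k ⇒ Pow D m
    ⟦ [] ⟧B     = !
    ⟦ x ∷ xs ⟧B = ⟨ ⟦ x ⟧M , ⟦ xs ⟧B ⟩

    ⟦_⟧M : ∀ {k x} → ScopedM k x → Pow D k ⇒ D
    ⟦ nothing ⟧M = ! ⨾ fail
    ⟦ just p ⟧M  = ⟦ p ⟧

module Submission where

open import Defs
open import Data.Nat using (ℕ; zero; suc; _<_; _<?_; s≤s; z≤n)
open import Data.Fin using (Fin; zero; suc; fromℕ<; opposite; fromℕ; inject₁)
open import Data.Vec using (Vec; []; _∷_; lookup)
open import Data.Maybe using (Maybe; just; nothing)
open import Data.Empty using (⊥-elim)
open import Function using (_∘_)
open import Relation.Nullary using (yes; no; ¬_)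
open import Relation.Binary using (Setoid)
open import Relation.Binary.PropositionalEquality using (_≡_; refl; cong; subst)
open import Relation.Binary.Construct.Closure.ReflexiveTransitive using (ε; _◅_)
open import Relation.Binary.Construct.Closure.Symmetric using (fwd; bwd)
import Relation.Binary.Reasoning.Setoid as SetoidReasoning

-- Every term, scoped or not, is interpreted in an arbitrary environment
-- ℕ → X ⇒ D over an arbitrary object X.  This semantics is natural in X
-- and commutes with renaming and substitution, and each of the six rules is
-- one of the axioms D1–D6 read on generalized elements X ⇒ D.  The
-- interpretation ⟦_⟧ of the statement is the instance X = Dᵏ, with the
-- variables sent to the projections.

module CCCProperties {o ℓ e} (𝒞 : CCC o ℓ e) where
  open CCC 𝒞
  open CCCKit 𝒞

  hom-setoid : Obj → Obj → Setoid ℓ e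
  hom-setoid A B = record
    { Carrier = A ⇒ B ; _≈_ = _≈_ ; isEquivalence = ≈-isEquivalence }

  module HomReasoning {A B : Obj} where
    open Setoid (hom-setoid A B) public
      using () renaming (refl to ≈-refl; sym to ≈-sym; trans to ≈-trans)
    open SetoidReasoning (hom-setoid A B) public
  open HomReasoning public

  ⨾-resp-≈ˡ : ∀ {A B C} {f f′ : A ⇒ B} {g : B ⇒ C} → f ≈ f′ → f ⨾ g ≈ f′ ⨾ g
  ⨾-resp-≈ˡ p = ⨾-resp-≈ p ≈-refl

  ⨾-resp-≈ʳ : ∀ {A B C} {f : A ⇒ B} {g g′ : B ⇒ C} → g ≈ g′ → f ⨾ g ≈ f ⨾ g′
  ⨾-resp-≈ʳ p = ⨾-resp-≈ ≈-refl p

  sym-assoc : ∀ {A B C E} {f : A ⇒ B} {g : B ⇒ C} {h : C ⇒ E} →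
              f ⨾ (g ⨾ h) ≈ (f ⨾ g) ⨾ h
  sym-assoc = ≈-sym assoc

  !-unique₂ : ∀ {A} {f g : A ⇒ ⊤} → f ≈ g
  !-unique₂ {f = f} {g} = ≈-trans (!-unique f) (≈-sym (!-unique g))

  ⟨⟩-cong₂ : ∀ {C A B} {f f′ : C ⇒ A} {g g′ : C ⇒ B} →
             f ≈ f′ → g ≈ g′ → ⟨ f , g ⟩ ≈ ⟨ f′ , g′ ⟩
  ⟨⟩-cong₂ p q = ⟨⟩-unique (≈-trans π₁-β p) (≈-trans π₂-β q)

  ⟨⟩-η : ∀ {C A B} {h : C ⇒ A × B} → h ≈ ⟨ h ⨾ π₁ , h ⨾ π₂ ⟩
  ⟨⟩-η = ⟨⟩-unique ≈-refl ≈-refl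

  ⨾-distrib-⟨⟩ : ∀ {X C A B} {h : X ⇒ C} {f : C ⇒ A} {g : C ⇒ B} →
                 h ⨾ ⟨ f , g ⟩ ≈ ⟨ h ⨾ f , h ⨾ g ⟩
  ⨾-distrib-⟨⟩ = ⟨⟩-unique (≈-trans assoc (⨾-resp-≈ʳ π₁-β))
                           (≈-trans assoc (⨾-resp-≈ʳ π₂-β))

  ⟨⟩⨾⊗ : ∀ {X A B A′ B′} {f : X ⇒ A} {g : X ⇒ B} {h : A ⇒ A′} {k : B ⇒ B′} →
         ⟨ f , g ⟩ ⨾ (h ⊗ k) ≈ ⟨ f ⨾ h , g ⨾ k ⟩
  ⟨⟩⨾⊗ = ≈-trans ⨾-distrib-⟨⟩ (⟨⟩-cong₂ (≈-trans sym-assoc (⨾-resp-≈ˡ π₁-β))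
                                        (≈-trans sym-assoc (⨾-resp-≈ˡ π₂-β)))

  ⟨⟩⨾⊗id : ∀ {X A B A′} {f : X ⇒ A} {g : X ⇒ B} {h : A ⇒ A′} →
           ⟨ f , g ⟩ ⨾ (h ⊗ id) ≈ ⟨ f ⨾ h , g ⟩
  ⟨⟩⨾⊗id = ≈-trans ⟨⟩⨾⊗ (⟨⟩-cong₂ ≈-refl identityʳ)

  ⟨⟩⨾id⊗ : ∀ {X A B B′} {f : X ⇒ A} {g : X ⇒ B} {k : B ⇒ B′} →
           ⟨ f , g ⟩ ⨾ (id ⊗ k) ≈ ⟨ f , g ⨾ k ⟩
  ⟨⟩⨾id⊗ = ≈-trans ⟨⟩⨾⊗ (⟨⟩-cong₂ identityʳ ≈-refl)

  ⟨⟨⟩⟩⨾α : ∀ {X A B C} {a : X ⇒ A} {b : X ⇒ B} {c : X ⇒ C} →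
           ⟨ ⟨ a , b ⟩ , c ⟩ ⨾ α ≈ ⟨ a , ⟨ b , c ⟩ ⟩
  ⟨⟨⟩⟩⨾α = ≈-trans ⨾-distrib-⟨⟩ (⟨⟩-cong₂ (project π₁-β)
             (≈-trans ⨾-distrib-⟨⟩ (⟨⟩-cong₂ (project π₂-β) π₂-β)))
    where
      project : ∀ {X A B C E} {a : X ⇒ A} {b : X ⇒ B} {c : X ⇒ C}
                  {p : A × B ⇒ E} {x : X ⇒ E} →
                ⟨ a , b ⟩ ⨾ p ≈ x → ⟨ ⟨ a , b ⟩ , c ⟩ ⨾ (π₁ ⨾ p) ≈ x
      project q = ≈-trans sym-assoc (≈-trans (⨾-resp-≈ˡ π₁-β) q)

  Λ-cong : ∀ {C A B} {f g : C × A ⇒ B} → f ≈ g → Λ f ≈ Λ g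
  Λ-cong p = Λ-unique (≈-trans Λ-β p)

  ⨾-Λ : ∀ {X C A B} {h : X ⇒ C} {f : C × A ⇒ B} → h ⨾ Λ f ≈ Λ ((h ⊗ id) ⨾ f)
  ⨾-Λ {h = h} {f} = Λ-unique (begin
    ((h ⨾ Λ f) ⊗ id) ⨾ ev          ≈⟨ ⨾-resp-≈ˡ (≈-trans ⟨⟩⨾⊗ (⟨⟩-cong₂ assoc identityʳ)) ⟨
    ((h ⊗ id) ⨾ (Λ f ⊗ id)) ⨾ ev   ≈⟨ assoc ⟩
    (h ⊗ id) ⨾ ((Λ f ⊗ id) ⨾ ev)   ≈⟨ ⨾-resp-≈ʳ Λ-β ⟩
    (h ⊗ id) ⨾ f                   ∎)

  ⟨Λ,⟩⨾ev : ∀ {X A B} {f : X × A ⇒ B} {g : X ⇒ A} → ⟨ Λ f , g ⟩ ⨾ ev ≈ ⟨ id , g ⟩ ⨾ f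
  ⟨Λ,⟩⨾ev {f = f} {g} = begin
    ⟨ Λ f , g ⟩ ⨾ ev                ≈⟨ ⨾-resp-≈ˡ (≈-trans ⟨⟩⨾⊗ (⟨⟩-cong₂ identityˡ identityʳ)) ⟨
    (⟨ id , g ⟩ ⨾ (Λ f ⊗ id)) ⨾ ev  ≈⟨ assoc ⟩
    ⟨ id , g ⟩ ⨾ ((Λ f ⊗ id) ⨾ ev)  ≈⟨ ⨾-resp-≈ʳ Λ-β ⟩
    ⟨ id , g ⟩ ⨾ f                  ∎

  tuple-proj : ∀ {X D} k (f : Fin k → X ⇒ D) i → tuple k f ⨾ proj k i ≈ f i
  tuple-proj (suc k) f zero    = π₁-β
  tuple-proj (suc k) f (suc i) =
    ≈-trans sym-assoc (≈-trans (⨾-resp-≈ˡ π₂-β) (tuple-proj k (f ∘ suc) i))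

  proj-ext : ∀ {X D} k {f g : X ⇒ Pow D k} →
             (∀ i → f ⨾ proj k i ≈ g ⨾ proj k i) → f ≈ g
  proj-ext zero    _ = !-unique₂
  proj-ext (suc k) {f} {g} f≈g = begin
    f                    ≈⟨ ⟨⟩-η ⟩
    ⟨ f ⨾ π₁ , f ⨾ π₂ ⟩  ≈⟨ ⟨⟩-cong₂ (f≈g zero) (proj-ext k tail≈) ⟩
    ⟨ g ⨾ π₁ , g ⨾ π₂ ⟩  ≈⟨ ⟨⟩-η ⟨
    g                    ∎
    where
      tail≈ : ∀ i → (f ⨾ π₂) ⨾ proj k i ≈ (g ⨾ π₂) ⨾ proj k i
      tail≈ i = ≈-trans assoc (≈-trans (f≈g (suc i)) sym-assoc)

  snoc⨾proj-fromℕ : ∀ {D} k → snoc {D} k ⨾ proj (suc k) (fromℕ k) ≈ π₂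
  snoc⨾proj-fromℕ zero    = π₁-β
  snoc⨾proj-fromℕ (suc k) =
    ≈-trans sym-assoc (≈-trans (⨾-resp-≈ˡ π₂-β)
      (≈-trans assoc (≈-trans (⨾-resp-≈ʳ (snoc⨾proj-fromℕ k)) π₂-β)))

  snoc⨾proj-inject₁ : ∀ {D} k (i : Fin k) →
                      snoc {D} k ⨾ proj (suc k) (inject₁ i) ≈ π₁ ⨾ proj k i
  snoc⨾proj-inject₁ (suc k) zero    = π₁-β
  snoc⨾proj-inject₁ (suc k) (suc i) = begin
    snoc (suc k) ⨾ (π₂ ⨾ proj (suc k) (inject₁ i))          ≈⟨ ≈-trans sym-assoc (⨾-resp-≈ˡ π₂-β) ⟩
    (⟨ π₁ ⨾ π₂ , π₂ ⟩ ⨾ snoc k) ⨾ proj (suc k) (inject₁ i)  ≈⟨ ≈-trans assoc (⨾-resp-≈ʳ (snoc⨾proj-inject₁ k i)) ⟩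
    ⟨ π₁ ⨾ π₂ , π₂ ⟩ ⨾ (π₁ ⨾ proj k i)                      ≈⟨ ≈-trans sym-assoc (≈-trans (⨾-resp-≈ˡ π₁-β) assoc) ⟩
    π₁ ⨾ (π₂ ⨾ proj k i)                                    ∎

module ModelProperties {o ℓ e} {𝒞 : CCC o ℓ e} {n : ℕ} (M : LCModel 𝒞 n) where
  open CCC 𝒞
  open CCCKit 𝒞
  open CCCProperties 𝒞
  open LCModel M renaming (case to caseᴹ)

  infixl 9 _∙_
  _∙_ : ∀ {X} → X ⇒ D → X ⇒ D → X ⇒ D
  f ∙ g = ⟨ f , g ⟩ ⨾ (app ⊗ id) ⨾ ev

  ⟪_⟫·_ : ∀ {X} → X ⇒ Pow D n → X ⇒ D → X ⇒ D
  ⟪ b ⟫· t = ⟨ b , t ⟩ ⨾ caseᴹ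

  ∙-cong₂ : ∀ {X} {f f′ g g′ : X ⇒ D} → f ≈ f′ → g ≈ g′ → f ∙ g ≈ f′ ∙ g′
  ∙-cong₂ p q = ⨾-resp-≈ˡ (⟨⟩-cong₂ p q)

  ⟪⟫-cong₂ : ∀ {X} {b b′ : X ⇒ Pow D n} {t t′ : X ⇒ D} →
             b ≈ b′ → t ≈ t′ → ⟪ b ⟫· t ≈ ⟪ b′ ⟫· t′
  ⟪⟫-cong₂ p q = ⨾-resp-≈ˡ (⟨⟩-cong₂ p q)

  ⨾-distrib-∙ : ∀ {X Y} {h : Y ⇒ X} {f g : X ⇒ D} → h ⨾ (f ∙ g) ≈ (h ⨾ f) ∙ (h ⨾ g)
  ⨾-distrib-∙ = ≈-trans sym-assoc (⨾-resp-≈ˡ ⨾-distrib-⟨⟩)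

  ⨾-distrib-⟪⟫ : ∀ {X Y} {h : Y ⇒ X} {b : X ⇒ Pow D n} {t : X ⇒ D} →
                 h ⨾ (⟪ b ⟫· t) ≈ ⟪ h ⨾ b ⟫· (h ⨾ t)
  ⨾-distrib-⟪⟫ = ≈-trans sym-assoc (⨾-resp-≈ˡ ⨾-distrib-⟨⟩)

  ∙-unfold : ∀ {X} {f g : X ⇒ D} → f ∙ g ≈ ⟨ f ⨾ app , g ⟩ ⨾ ev
  ∙-unfold = ≈-trans sym-assoc (⨾-resp-≈ˡ ⟨⟩⨾⊗id)

  lam-β : ∀ {X} {f : X × D ⇒ D} {g : X ⇒ D} → (Λ f ⨾ lam) ∙ g ≈ ⟨ id , g ⟩ ⨾ f
  lam-β {f = f} {g} = begin
    (Λ f ⨾ lam) ∙ g                 ≈⟨ ∙-unfold ⟩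
    ⟨ (Λ f ⨾ lam) ⨾ app , g ⟩ ⨾ ev  ≈⟨ ⨾-resp-≈ˡ (⟨⟩-cong₂ lam⨾app ≈-refl) ⟩
    ⟨ Λ f , g ⟩ ⨾ ev                ≈⟨ ⟨Λ,⟩⨾ev ⟩
    ⟨ id , g ⟩ ⨾ f                  ∎
    where
      lam⨾app : (Λ f ⨾ lam) ⨾ app ≈ Λ f
      lam⨾app = ≈-trans assoc (≈-trans (⨾-resp-≈ʳ D1a) identityʳ)

  lam-η : ∀ {X} {f : X ⇒ D} → Λ ((π₁ ⨾ f) ∙ π₂) ⨾ lam ≈ f
  lam-η {f = f} = begin
    Λ ((π₁ ⨾ f) ∙ π₂) ⨾ lam  ≈⟨ ⨾-resp-≈ˡ (≈-sym (Λ-unique (≈-sym curried))) ⟩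
    (f ⨾ app) ⨾ lam          ≈⟨ assoc ⟩
    f ⨾ (app ⨾ lam)          ≈⟨ ⨾-resp-≈ʳ D1b ⟩
    f ⨾ id                   ≈⟨ identityʳ ⟩
    f                        ∎
    where
      curried : (π₁ ⨾ f) ∙ π₂ ≈ ((f ⨾ app) ⊗ id) ⨾ ev
      curried = ≈-trans ∙-unfold (⨾-resp-≈ˡ (⟨⟩-cong₂ assoc (≈-sym identityʳ)))

  case-con : ∀ {X} {b : X ⇒ Pow D n} (c : Fin n) → ⟪ b ⟫· (! ⨾ cbar c) ≈ b ⨾ proj n c
  case-con {b = b} c = begin
    ⟨ b , ! ⨾ cbar c ⟩ ⨾ caseᴹ                   ≈⟨ ⨾-resp-≈ˡ pair ⟨
    (b ⨾ (⟨ id , ! ⟩ ⨾ (id ⊗ cbar c))) ⨾ caseᴹ  ≈⟨ assoc ⟩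
    b ⨾ ((⟨ id , ! ⟩ ⨾ (id ⊗ cbar c)) ⨾ caseᴹ)  ≈⟨ ⨾-resp-≈ʳ (≈-trans assoc (D2 c)) ⟩
    b ⨾ proj n c                                ∎
    where
      pair : b ⨾ (⟨ id , ! ⟩ ⨾ (id ⊗ cbar c)) ≈ ⟨ b , ! ⨾ cbar c ⟩
      pair = ≈-trans (⨾-resp-≈ʳ ⟨⟩⨾id⊗) (≈-trans ⨾-distrib-⟨⟩
               (⟨⟩-cong₂ identityʳ (≈-trans sym-assoc (⨾-resp-≈ˡ !-unique₂))))

  case-app : ∀ {X} {b : X ⇒ Pow D n} {t u : X ⇒ D} → (⟪ b ⟫· t) ∙ u ≈ ⟪ b ⟫· (t ∙ u)
  case-app {b = b} {t} {u} = begin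
    ⟨ ⟨ b , t ⟩ ⨾ caseᴹ , u ⟩ ⨾ ((app ⊗ id) ⨾ ev)
      ≈⟨ ⨾-resp-≈ˡ ⟨⟩⨾⊗id ⟨
    (⟨ ⟨ b , t ⟩ , u ⟩ ⨾ (caseᴹ ⊗ id)) ⨾ ((app ⊗ id) ⨾ ev)
      ≈⟨ ≈-trans assoc (⨾-resp-≈ʳ D3) ⟩
    ⟨ ⟨ b , t ⟩ , u ⟩ ⨾ (α ⨾ ((id ⊗ (app ⊗ id)) ⨾ ((id ⊗ ev) ⨾ caseᴹ)))
      ≈⟨ ≈-trans sym-assoc (⨾-resp-≈ˡ ⟨⟨⟩⟩⨾α) ⟩
    ⟨ b , ⟨ t , u ⟩ ⟩ ⨾ ((id ⊗ (app ⊗ id)) ⨾ ((id ⊗ ev) ⨾ caseᴹ))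
      ≈⟨ ≈-trans sym-assoc (⨾-resp-≈ˡ ⟨⟩⨾id⊗) ⟩
    ⟨ b , ⟨ t , u ⟩ ⨾ (app ⊗ id) ⟩ ⨾ ((id ⊗ ev) ⨾ caseᴹ)
      ≈⟨ ≈-trans sym-assoc (⨾-resp-≈ˡ (≈-trans ⟨⟩⨾id⊗ (⟨⟩-cong₂ ≈-refl assoc))) ⟩
    ⟨ b , ⟨ t , u ⟩ ⨾ ((app ⊗ id) ⨾ ev) ⟩ ⨾ caseᴹ
      ∎

  case-lam : ∀ {X} {b : X ⇒ Pow D n} {f : X × D ⇒ D} →
             ⟪ b ⟫· (Λ f ⨾ lam) ≈ Λ (⟪ π₁ ⨾ b ⟫· f) ⨾ lam
  case-lam {b = b} {f} = begin
    ⟨ b , Λ f ⨾ lam ⟩ ⨾ caseᴹ            ≈⟨ ⨾-resp-≈ˡ ⟨⟩⨾id⊗ ⟨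
    (⟨ b , Λ f ⟩ ⨾ (id ⊗ lam)) ⨾ caseᴹ   ≈⟨ ≈-trans (⨾-resp-≈ʳ D4) sym-assoc ⟨
    ⟨ b , Λ f ⟩ ⨾ (caseHat ⨾ lam)        ≈⟨ ≈-trans sym-assoc (⨾-resp-≈ˡ (≈-trans ⨾-Λ (Λ-cong inner))) ⟩
    Λ (⟨ π₁ ⨾ b , f ⟩ ⨾ caseᴹ) ⨾ lam     ∎
    where
      evΛ : ⟨ π₁ ⨾ Λ f , π₂ ⟩ ⨾ ev ≈ f
      evΛ = ≈-trans (⨾-resp-≈ˡ (⟨⟩-cong₂ ≈-refl (≈-sym identityʳ))) Λ-β

      inner : (⟨ b , Λ f ⟩ ⊗ id) ⨾ (α ⨾ ((id ⊗ ev) ⨾ caseᴹ)) ≈ ⟨ π₁ ⨾ b , f ⟩ ⨾ caseᴹ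
      inner = begin
        (⟨ b , Λ f ⟩ ⊗ id) ⨾ (α ⨾ ((id ⊗ ev) ⨾ caseᴹ))
          ≈⟨ ≈-trans sym-assoc (⨾-resp-≈ˡ (≈-trans (⨾-resp-≈ˡ
               (⟨⟩-cong₂ ⨾-distrib-⟨⟩ identityʳ)) ⟨⟨⟩⟩⨾α)) ⟩
        ⟨ π₁ ⨾ b , ⟨ π₁ ⨾ Λ f , π₂ ⟩ ⟩ ⨾ ((id ⊗ ev) ⨾ caseᴹ)
          ≈⟨ ≈-trans sym-assoc (⨾-resp-≈ˡ (≈-trans ⟨⟩⨾id⊗ (⟨⟩-cong₂ ≈-refl evΛ))) ⟩
        ⟨ π₁ ⨾ b , f ⟩ ⨾ caseᴹ
          ∎

  case-case : ∀ {X} {b b′ : X ⇒ Pow D n} {t : X ⇒ D} →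
              ⟪ b ⟫· (⟪ b′ ⟫· t) ≈ ⟪ ⟨ b , b′ ⟩ ⨾ comp ⟫· t
  case-case {b = b} {b′} {t} = begin
    ⟨ b , ⟨ b′ , t ⟩ ⨾ caseᴹ ⟩ ⨾ caseᴹ              ≈⟨ ⨾-resp-≈ˡ ⟨⟩⨾id⊗ ⟨
    (⟨ b , ⟨ b′ , t ⟩ ⟩ ⨾ (id ⊗ caseᴹ)) ⨾ caseᴹ     ≈⟨ ⨾-resp-≈ˡ (⨾-resp-≈ˡ ⟨⟨⟩⟩⨾α) ⟨
    ((⟨ ⟨ b , b′ ⟩ , t ⟩ ⨾ α) ⨾ (id ⊗ caseᴹ)) ⨾ caseᴹ  ≈⟨ ≈-trans assoc assoc ⟩
    ⟨ ⟨ b , b′ ⟩ , t ⟩ ⨾ (α ⨾ ((id ⊗ caseᴹ) ⨾ caseᴹ))  ≈⟨ ⨾-resp-≈ʳ D5 ⟨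
    ⟨ ⟨ b , b′ ⟩ , t ⟩ ⨾ ((comp ⊗ id) ⨾ caseᴹ)         ≈⟨ ≈-trans sym-assoc (⨾-resp-≈ˡ ⟨⟩⨾⊗id) ⟩
    ⟨ ⟨ b , b′ ⟩ ⨾ comp , t ⟩ ⨾ caseᴹ                  ∎

  case-fail : ∀ {X} {b : X ⇒ Pow D n} → ⟪ b ⟫· (! ⨾ fail) ≈ ! ⨾ fail
  case-fail {b = b} = begin
    ⟨ b , ! ⨾ fail ⟩ ⨾ caseᴹ            ≈⟨ ⨾-resp-≈ˡ ⟨⟩⨾id⊗ ⟨
    (⟨ b , ! ⟩ ⨾ (id ⊗ fail)) ⨾ caseᴹ   ≈⟨ ≈-trans assoc (⨾-resp-≈ʳ D6) ⟩
    ⟨ b , ! ⟩ ⨾ (π₂ ⨾ fail)             ≈⟨ ≈-trans sym-assoc (⨾-resp-≈ˡ π₂-β) ⟩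
    ! ⨾ fail                            ∎

  comp⨾proj : ∀ {X} {b b′ : X ⇒ Pow D n} (i : Fin n) →
              (⟨ b , b′ ⟩ ⨾ comp) ⨾ proj n i ≈ ⟪ b ⟫· (b′ ⨾ proj n i)
  comp⨾proj {b = b} {b′} i = begin
    (⟨ b , b′ ⟩ ⨾ comp) ⨾ proj n i             ≈⟨ ≈-trans assoc (⨾-resp-≈ʳ (tuple-proj n _ i)) ⟩
    ⟨ b , b′ ⟩ ⨾ ((id ⊗ proj n i) ⨾ caseᴹ)     ≈⟨ ≈-trans sym-assoc (⨾-resp-≈ˡ ⟨⟩⨾id⊗) ⟩
    ⟨ b , b′ ⨾ proj n i ⟩ ⨾ caseᴹ              ∎

module Semantics {o ℓ e} {𝒞 : CCC o ℓ e} {n : ℕ} (M : LCModel 𝒞 n) where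
  open CCC 𝒞
  open CCCKit 𝒞
  open CCCProperties 𝒞
  open LCModel M renaming (case to caseᴹ)
  open ModelProperties M
  open Syntax n

  Env : Obj → Set ℓ
  Env X = ℕ → X ⇒ D

  infix 4 _≈ᵉ_
  _≈ᵉ_ : ∀ {X} → Env X → Env X → Set e
  γ ≈ᵉ δ = ∀ j → γ j ≈ δ j

  infixr 9 _⨾ᵉ_
  _⨾ᵉ_ : ∀ {X Y} → Y ⇒ X → Env X → Env Y
  (f ⨾ᵉ γ) j = f ⨾ γ j

  extend : ∀ {X} → Env X → Env (X × D)
  extend γ zero    = π₂
  extend γ (suc j) = π₁ ⨾ γ j

  mutual
    eval : ∀ {X} → Tm → Env X → X ⇒ D
    eval (var x)    γ = γ x
    eval (t · u)    γ = eval t γ ∙ eval u γ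
    eval (ƛ t)      γ = Λ (eval t (extend γ)) ⨾ lam
    eval (con c)    γ = ! ⨾ cbar c
    eval (case θ t) γ = ⟪ evalB θ γ ⟫· eval t γ

    evalB : ∀ {X m} → Vec (Maybe Tm) m → Env X → X ⇒ Pow D m
    evalB []       γ = !
    evalB (x ∷ xs) γ = ⟨ evalM x γ , evalB xs γ ⟩

    evalM : ∀ {X} → Maybe Tm → Env X → X ⇒ D
    evalM nothing  γ = ! ⨾ fail
    evalM (just t) γ = eval t γ

  extend-cong : ∀ {X} {γ δ : Env X} → γ ≈ᵉ δ → extend γ ≈ᵉ extend δ
  extend-cong γ≈δ zero    = ≈-refl
  extend-cong γ≈δ (suc j) = ⨾-resp-≈ʳ (γ≈δ j)

  mutual
    eval-cong : ∀ {X} t {γ δ : Env X} → γ ≈ᵉ δ → eval t γ ≈ eval t δ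
    eval-cong (var x)    γ≈δ = γ≈δ x
    eval-cong (t · u)    γ≈δ = ∙-cong₂ (eval-cong t γ≈δ) (eval-cong u γ≈δ)
    eval-cong (ƛ t)      γ≈δ = ⨾-resp-≈ˡ (Λ-cong (eval-cong t (extend-cong γ≈δ)))
    eval-cong (con c)    γ≈δ = ≈-refl
    eval-cong (case θ t) γ≈δ = ⟪⟫-cong₂ (evalB-cong θ γ≈δ) (eval-cong t γ≈δ)

    evalB-cong : ∀ {X m} (θ : Vec (Maybe Tm) m) {γ δ : Env X} →
                 γ ≈ᵉ δ → evalB θ γ ≈ evalB θ δ
    evalB-cong []       γ≈δ = ≈-refl
    evalB-cong (x ∷ xs) γ≈δ = ⟨⟩-cong₂ (evalM-cong x γ≈δ) (evalB-cong xs γ≈δ)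

    evalM-cong : ∀ {X} x {γ δ : Env X} → γ ≈ᵉ δ → evalM x γ ≈ evalM x δ
    evalM-cong nothing  γ≈δ = ≈-refl
    evalM-cong (just t) γ≈δ = eval-cong t γ≈δ

  extend-⨾ : ∀ {X Y} (f : Y ⇒ X) (γ : Env X) →
             (f ⊗ id) ⨾ᵉ extend γ ≈ᵉ extend (f ⨾ᵉ γ)
  extend-⨾ f γ zero    = ≈-trans π₂-β identityʳ
  extend-⨾ f γ (suc j) = ≈-trans sym-assoc (≈-trans (⨾-resp-≈ˡ π₁-β) assoc)

  mutual
    ⨾-eval : ∀ {X Y} (f : Y ⇒ X) t (γ : Env X) → f ⨾ eval t γ ≈ eval t (f ⨾ᵉ γ)
    ⨾-eval f (var x)    γ = ≈-refl
    ⨾-eval f (t · u)    γ = ≈-trans ⨾-distrib-∙ (∙-cong₂ (⨾-eval f t γ) (⨾-eval f u γ))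
    ⨾-eval f (ƛ t)      γ = ≈-trans sym-assoc (⨾-resp-≈ˡ (≈-trans ⨾-Λ (Λ-cong
                              (≈-trans (⨾-eval (f ⊗ id) t (extend γ))
                                       (eval-cong t (extend-⨾ f γ))))))
    ⨾-eval f (con c)    γ = ≈-trans sym-assoc (⨾-resp-≈ˡ !-unique₂)
    ⨾-eval f (case θ t) γ = ≈-trans ⨾-distrib-⟪⟫ (⟪⟫-cong₂ (⨾-evalB f θ γ) (⨾-eval f t γ))

    ⨾-evalB : ∀ {X Y m} (f : Y ⇒ X) (θ : Vec (Maybe Tm) m) (γ : Env X) →
              f ⨾ evalB θ γ ≈ evalB θ (f ⨾ᵉ γ)
    ⨾-evalB f []       γ = !-unique₂
    ⨾-evalB f (x ∷ xs) γ = ≈-trans ⨾-distrib-⟨⟩ (⟨⟩-cong₂ (⨾-evalM f x γ) (⨾-evalB f xs γ))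

    ⨾-evalM : ∀ {X Y} (f : Y ⇒ X) x (γ : Env X) → f ⨾ evalM x γ ≈ evalM x (f ⨾ᵉ γ)
    ⨾-evalM f nothing  γ = ≈-trans sym-assoc (⨾-resp-≈ˡ !-unique₂)
    ⨾-evalM f (just t) γ = ⨾-eval f t γ

  extend-ren : ∀ {X} (ρ : ℕ → ℕ) (γ : Env X) → extend γ ∘ ext ρ ≈ᵉ extend (γ ∘ ρ)
  extend-ren ρ γ zero    = ≈-refl
  extend-ren ρ γ (suc j) = ≈-refl

  mutual
    eval-ren : ∀ {X} (ρ : ℕ → ℕ) t (γ : Env X) → eval (ren ρ t) γ ≈ eval t (γ ∘ ρ)
    eval-ren ρ (var x)    γ = ≈-refl
    eval-ren ρ (t · u)    γ = ∙-cong₂ (eval-ren ρ t γ) (eval-ren ρ u γ)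
    eval-ren ρ (ƛ t)      γ = ⨾-resp-≈ˡ (Λ-cong (≈-trans (eval-ren (ext ρ) t (extend γ))
                                                        (eval-cong t (extend-ren ρ γ))))
    eval-ren ρ (con c)    γ = ≈-refl
    eval-ren ρ (case θ t) γ = ⟪⟫-cong₂ (evalB-renB ρ θ γ) (eval-ren ρ t γ)

    evalB-renB : ∀ {X m} (ρ : ℕ → ℕ) (θ : Vec (Maybe Tm) m) (γ : Env X) →
                 evalB (renB ρ θ) γ ≈ evalB θ (γ ∘ ρ)
    evalB-renB ρ []       γ = ≈-refl
    evalB-renB ρ (x ∷ xs) γ = ⟨⟩-cong₂ (evalM-renM ρ x γ) (evalB-renB ρ xs γ)

    evalM-renM : ∀ {X} (ρ : ℕ → ℕ) x (γ : Env X) → evalM (renM ρ x) γ ≈ evalM x (γ ∘ ρ)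
    evalM-renM ρ nothing  γ = ≈-refl
    evalM-renM ρ (just t) γ = eval-ren ρ t γ

  eval-↑ : ∀ {X} t (γ : Env X) → eval (↑ t) (extend γ) ≈ π₁ ⨾ eval t γ
  eval-↑ t γ = ≈-trans (eval-ren suc t (extend γ)) (≈-sym (⨾-eval π₁ t γ))

  evalB-↑B : ∀ {X} (θ : Binding) (γ : Env X) → evalB (↑B θ) (extend γ) ≈ π₁ ⨾ evalB θ γ
  evalB-↑B θ γ = ≈-trans (evalB-renB suc θ (extend γ)) (≈-sym (⨾-evalB π₁ θ γ))

  extend-sub : ∀ {X} (σ : ℕ → Tm) (γ : Env X) →
               (λ j → eval (exts σ j) (extend γ)) ≈ᵉ extend (λ j → eval (σ j) γ)
  extend-sub σ γ zero    = ≈-refl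
  extend-sub σ γ (suc j) = eval-↑ (σ j) γ

  mutual
    eval-sub : ∀ {X} (σ : ℕ → Tm) t (γ : Env X) →
               eval (sub σ t) γ ≈ eval t (λ j → eval (σ j) γ)
    eval-sub σ (var x)    γ = ≈-refl
    eval-sub σ (t · u)    γ = ∙-cong₂ (eval-sub σ t γ) (eval-sub σ u γ)
    eval-sub σ (ƛ t)      γ = ⨾-resp-≈ˡ (Λ-cong (≈-trans (eval-sub (exts σ) t (extend γ))
                                                        (eval-cong t (extend-sub σ γ))))
    eval-sub σ (con c)    γ = ≈-refl
    eval-sub σ (case θ t) γ = ⟪⟫-cong₂ (evalB-subB σ θ γ) (eval-sub σ t γ)

    evalB-subB : ∀ {X m} (σ : ℕ → Tm) (θ : Vec (Maybe Tm) m) (γ : Env X) →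
                 evalB (subB σ θ) γ ≈ evalB θ (λ j → eval (σ j) γ)
    evalB-subB σ []       γ = ≈-refl
    evalB-subB σ (x ∷ xs) γ = ⟨⟩-cong₂ (evalM-subM σ x γ) (evalB-subB σ xs γ)

    evalM-subM : ∀ {X} (σ : ℕ → Tm) x (γ : Env X) →
                 evalM (subM σ x) γ ≈ evalM x (λ j → eval (σ j) γ)
    evalM-subM σ nothing  γ = ≈-refl
    evalM-subM σ (just t) γ = eval-sub σ t γ

  eval-[] : ∀ {X} t u (γ : Env X) → eval (t [ u ]) γ ≈ ⟨ id , eval u γ ⟩ ⨾ eval t (extend γ)
  eval-[] t u γ = ≈-trans (eval-sub (σ₀ u) t γ)
                          (≈-trans (eval-cong t σ₀≈) (≈-sym (⨾-eval ⟨ id , eval u γ ⟩ t (extend γ))))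
    where
      σ₀≈ : (λ j → eval (σ₀ u j) γ) ≈ᵉ ⟨ id , eval u γ ⟩ ⨾ᵉ extend γ
      σ₀≈ zero    = ≈-sym π₂-β
      σ₀≈ (suc j) = ≈-sym (≈-trans sym-assoc (≈-trans (⨾-resp-≈ˡ π₁-β) identityˡ))

  evalB⨾proj : ∀ {X m} (θ : Vec (Maybe Tm) m) (i : Fin m) (γ : Env X) →
               evalB θ γ ⨾ proj m i ≈ evalM (lookup θ i) γ
  evalB⨾proj (x ∷ xs) zero    γ = π₁-β
  evalB⨾proj (x ∷ xs) (suc i) γ = ≈-trans sym-assoc (≈-trans (⨾-resp-≈ˡ π₂-β) (evalB⨾proj xs i γ))

  ∋↦⇒lookup : ∀ {m} (θ : Vec (Maybe Tm) m) c {u} → θ ∋ c ↦ u → lookup θ c ≡ just u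
  ∋↦⇒lookup (x ∷ xs) zero    x≡u   = x≡u
  ∋↦⇒lookup (x ∷ xs) (suc c) xs∋c↦u = ∋↦⇒lookup xs c xs∋c↦u

  lookup-compB : ∀ {m} θ (φ : Vec (Maybe Tm) m) i → lookup (compB θ φ) i ≡ compM θ (lookup φ i)
  lookup-compB θ (x ∷ xs) zero    = refl
  lookup-compB θ (x ∷ xs) (suc i) = lookup-compB θ xs i

  case-evalM : ∀ {X} θ x (γ : Env X) → ⟪ evalB θ γ ⟫· evalM x γ ≈ evalM (compM θ x) γ
  case-evalM θ nothing  γ = case-fail
  case-evalM θ (just t) γ = ≈-refl

  comp-evalB : ∀ {X} θ φ (γ : Env X) → ⟨ evalB θ γ , evalB φ γ ⟩ ⨾ comp ≈ evalB (compB θ φ) γ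
  comp-evalB θ φ γ = proj-ext n λ i → begin
    (⟨ evalB θ γ , evalB φ γ ⟩ ⨾ comp) ⨾ proj n i  ≈⟨ comp⨾proj i ⟩
    ⟪ evalB θ γ ⟫· (evalB φ γ ⨾ proj n i)         ≈⟨ ⟪⟫-cong₂ ≈-refl (evalB⨾proj φ i γ) ⟩
    ⟪ evalB θ γ ⟫· evalM (lookup φ i) γ           ≈⟨ case-evalM θ (lookup φ i) γ ⟩
    evalM (compM θ (lookup φ i)) γ                ≡⟨ cong (λ x → evalM x γ) (lookup-compB θ φ i) ⟨
    evalM (lookup (compB θ φ) i) γ                ≈⟨ evalB⨾proj (compB θ φ) i γ ⟨
    evalB (compB θ φ) γ ⨾ proj n i                ∎

  mutual
    ⟶-sound : ∀ {s s′} → s ⟶ s′ → ∀ {X} (γ : Env X) → eval s γ ≈ eval s′ γ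
    ⟶-sound (AppLam {t} {u})          γ = ≈-trans lam-β (≈-sym (eval-[] t u γ))
    ⟶-sound (LamApp {t})              γ =
      ≈-trans (⨾-resp-≈ˡ (Λ-cong (∙-cong₂ (eval-↑ t γ) ≈-refl))) lam-η
    ⟶-sound (CaseCons {θ} {c} θ∋c↦u) γ = ≈-trans (case-con c)
      (subst (λ x → evalB θ γ ⨾ proj n c ≈ evalM x γ) (∋↦⇒lookup θ c θ∋c↦u) (evalB⨾proj θ c γ))
    ⟶-sound CaseApp                   γ = ≈-sym case-app
    ⟶-sound (CaseLam {θ})             γ =
      ≈-trans case-lam (⨾-resp-≈ˡ (Λ-cong (⟪⟫-cong₂ (≈-sym (evalB-↑B θ γ)) ≈-refl)))
    ⟶-sound (CaseCase {θ} {φ})        γ =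
      ≈-trans case-case (⟪⟫-cong₂ (comp-evalB θ φ γ) ≈-refl)
    ⟶-sound (ξ-appˡ r)  γ = ∙-cong₂ (⟶-sound r γ) ≈-refl
    ⟶-sound (ξ-appʳ r)  γ = ∙-cong₂ ≈-refl (⟶-sound r γ)
    ⟶-sound (ξ-lam r)   γ = ⨾-resp-≈ˡ (Λ-cong (⟶-sound r (extend γ)))
    ⟶-sound (ξ-caseB r) γ = ⟪⟫-cong₂ (⟶B-sound r γ) ≈-refl
    ⟶-sound (ξ-case r)  γ = ⟪⟫-cong₂ ≈-refl (⟶-sound r γ)

    ⟶B-sound : ∀ {m} {θ θ′ : Vec (Maybe Tm) m} → θ ⟶B θ′ →
               ∀ {X} (γ : Env X) → evalB θ γ ≈ evalB θ′ γ
    ⟶B-sound (here r)  γ = ⟨⟩-cong₂ (⟶-sound r γ) ≈-refl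
    ⟶B-sound (there r) γ = ⟨⟩-cong₂ ≈-refl (⟶B-sound r γ)

  ≡λC-sound : ∀ {s s′} → s ≡λC s′ → ∀ {X} (γ : Env X) → eval s γ ≈ eval s′ γ
  ≡λC-sound ε              γ = ≈-refl
  ≡λC-sound (fwd r ◅ rs) γ = ≈-trans (⟶-sound r γ) (≡λC-sound rs γ)
  ≡λC-sound (bwd r ◅ rs) γ = ≈-trans (≈-sym (⟶-sound r γ)) (≡λC-sound rs γ)

  -- Indices outside the context get the junk value ! ⨾ fail; no scoped
  -- term reads them.
  env : ∀ k → Env (Pow D k)
  env k j with j <? k
  ... | yes j<k = proj k (opposite (fromℕ< j<k))
  ... | no  _   = ! ⨾ fail

  env-< : ∀ k j (j<k : j < k) → env k j ≡ proj k (opposite (fromℕ< j<k))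
  env-< k j j<k with j <? k
  ... | yes _   = refl
  ... | no  j≮k = ⊥-elim (j≮k j<k)

  env-≮ : ∀ k j → ¬ (j < k) → env k j ≡ ! ⨾ fail
  env-≮ k j j≮k with j <? k
  ... | yes j<k = ⊥-elim (j≮k j<k)
  ... | no  _   = refl

  snoc⨾env : ∀ k → snoc k ⨾ᵉ env (suc k) ≈ᵉ extend (env k)
  snoc⨾env k zero rewrite env-< (suc k) zero (s≤s z≤n) = snoc⨾proj-fromℕ k
  snoc⨾env k (suc j) with j <? k
  ... | yes j<k rewrite env-< (suc k) (suc j) (s≤s j<k) =
        snoc⨾proj-inject₁ k (opposite (fromℕ< j<k))
  ... | no  j≮k rewrite env-≮ (suc k) (suc j) (λ { (s≤s j<k) → j≮k j<k }) =
        ≈-trans sym-assoc (≈-trans (⨾-resp-≈ˡ !-unique₂) assoc)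

  open Interp 𝒞 M

  mutual
    ⟦⟧≈eval : ∀ {k t} (p : Scoped k t) → ⟦ p ⟧ ≈ eval t (env k)
    ⟦⟧≈eval {k} {var j} (var j<k) rewrite env-< k j j<k = ≈-refl
    ⟦⟧≈eval (p · q)      = ∙-cong₂ (⟦⟧≈eval p) (⟦⟧≈eval q)
    ⟦⟧≈eval {k} {ƛ t} (ƛ p) = ⨾-resp-≈ˡ (Λ-cong (begin
      snoc k ⨾ ⟦ p ⟧                  ≈⟨ ⨾-resp-≈ʳ (⟦⟧≈eval p) ⟩
      snoc k ⨾ eval t (env (suc k))   ≈⟨ ⨾-eval (snoc k) t (env (suc k)) ⟩
      eval t (snoc k ⨾ᵉ env (suc k))  ≈⟨ eval-cong t (snoc⨾env k) ⟩
      eval t (extend (env k))         ∎))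
    ⟦⟧≈eval con          = ≈-refl
    ⟦⟧≈eval (case pθ p)  = ⟪⟫-cong₂ (⟦⟧B≈evalB pθ) (⟦⟧≈eval p)

    ⟦⟧B≈evalB : ∀ {k m} {θ : Vec (Maybe Tm) m} (p : ScopedB k θ) → ⟦ p ⟧B ≈ evalB θ (env k)
    ⟦⟧B≈evalB []       = ≈-refl
    ⟦⟧B≈evalB (x ∷ xs) = ⟨⟩-cong₂ (⟦⟧M≈evalM x) (⟦⟧B≈evalB xs)

    ⟦⟧M≈evalM : ∀ {k x} (p : ScopedM k x) → ⟦ p ⟧M ≈ evalM x (env k)
    ⟦⟧M≈evalM nothing  = ≈-refl
    ⟦⟧M≈evalM (just p) = ⟦⟧≈eval p

theorem1 : ∀ {o ℓ e} (𝒞 : CCC o ℓ e) {n : ℕ} (M : LCModel 𝒞 n) (k : ℕ)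
           (t t′ : Syntax.Tm n)
           (p : Syntax.Scoped n k t) (p′ : Syntax.Scoped n k t′) →
           Syntax._≡λC_ n t t′ →
           CCC._≈_ 𝒞 (Interp.⟦_⟧ 𝒞 M p) (Interp.⟦_⟧ 𝒞 M p′)
theorem1 𝒞 M k t t′ p p′ t≡t′ = begin
  ⟦ p ⟧             ≈⟨ ⟦⟧≈eval p ⟩
  eval t (env k)    ≈⟨ ≡λC-sound t≡t′ (env k) ⟩
  eval t′ (env k)   ≈⟨ ⟦⟧≈eval p′ ⟨
  ⟦ p′ ⟧            ∎
  where
    open CCCProperties 𝒞
    open Semantics M
    open Interp 𝒞 M
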